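{- The variety of all QB-algebras has the congruence extension property: for every QB-algebra $\mathbf{Q}$, every subalgebra $\mathbf{Q}_0$ of $\mathbf{Q}$ and every congruence $\theta_0$ on $\mathbf{Q}_0$, there exists a congruence $\theta$ on $\mathbf{Q}$ with $\theta_0=\theta\cap Q_0^{2}$.
   Context: A quasi-lattice is an algebra $\langle L;\vee,\wedge\rangle$ such that for all $x,y,z$: $\vee,\wedge$ are commutative and associative; $x\vee(x\wedge y)=x\vee x$ and $x\wedge(x\vee y)=x\wedge x$; $x\vee(y\vee y)=x\vee y$ and $x\wedge(y\wedge y)=x\wedge y$; $x\vee x=x\wedge x$. It is distributive if $x\vee(y\wedge z)=(x\vee y)\wedge(x\vee z)$ and $x\wedge(y\vee z)=(x\wedge y)\vee(x\wedge z)$. A quasi-Boolean algebra (QB-algebra) is an algebra $\langle Q;\vee,\wedge,{}^{*},0,1\rangle$ of type $\langle 2,2,1,0,0\rangle$ such that $\langle Q;\vee,\wedge\rangle$ is a distributive quasi-lattice and for all $x$: $x\vee 1=1$, $x\wedge 0=0$, $x\vee x^{*}=1$, $x\wedge x^{*}=0$, $(x\wedge x)^{*}=x^{*}\vee x^{*}$, $x^{**}=x$. -}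

module Defs where

open import Level using (Level; _⊔_; suc)
open import Data.Product using (Σ; _×_; _,_; proj₁; proj₂; ∃)
open import Relation.Binary.PropositionalEquality using (_≡_)

record QBAlgebra : Set₁ where
  infixr 6 _∨_
  infixr 7 _∧_
  field
    Carrier : Set
    _∨_ _∧_ : Carrier → Carrier → Carrier
    _* : Carrier → Carrier
    𝟎 𝟏 : Carrier
    ∨-comm : ∀ x y → x ∨ y ≡ y ∨ x
    ∧-comm : ∀ x y → x ∧ y ≡ y ∧ x
    ∨-assoc : ∀ x y z → (x ∨ y) ∨ z ≡ x ∨ (y ∨ z)
    ∧-assoc : ∀ x y z → (x ∧ y) ∧ z ≡ x ∧ (y ∧ z)
    ∨-absorb : ∀ x y → x ∨ (x ∧ y) ≡ x ∨ x
    ∧-absorb : ∀ x y → x ∧ (x ∨ y) ≡ x ∧ x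
    ∨-idem-r : ∀ x y → x ∨ (y ∨ y) ≡ x ∨ y
    ∧-idem-r : ∀ x y → x ∧ (y ∧ y) ≡ x ∧ y
    ∨∧-diag : ∀ x → x ∨ x ≡ x ∧ x
    ∨-distrib-∧ : ∀ x y z → x ∨ (y ∧ z) ≡ (x ∨ y) ∧ (x ∨ z)
    ∧-distrib-∨ : ∀ x y z → x ∧ (y ∨ z) ≡ (x ∧ y) ∨ (x ∧ z)
    ∨-𝟏 : ∀ x → x ∨ 𝟏 ≡ 𝟏
    ∧-𝟎 : ∀ x → x ∧ 𝟎 ≡ 𝟎
    ∨-compl : ∀ x → x ∨ (x *) ≡ 𝟏
    ∧-compl : ∀ x → x ∧ (x *) ≡ 𝟎
    *-∧∧ : ∀ x → (x ∧ x) * ≡ (x *) ∨ (x *)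
    *-invol : ∀ x → (x *) * ≡ x

module _ (Q : QBAlgebra) where
  open QBAlgebra Q

  record IsSubuniverse (P : Carrier → Set) : Set where
    field
      prop : ∀ {x} (p q : P x) → p ≡ q
      ∨-closed : ∀ {x y} → P x → P y → P (x ∨ y)
      ∧-closed : ∀ {x y} → P x → P y → P (x ∧ y)
      *-closed : ∀ {x} → P x → P (x *)
      𝟎-closed : P 𝟎
      𝟏-closed : P 𝟏

  record IsCongruence (θ : Carrier → Carrier → Set) : Set where
    field
      refl  : ∀ {x} → θ x x
      sym   : ∀ {x y} → θ x y → θ y x
      trans : ∀ {x y z} → θ x y → θ y z → θ x z
      ∨-cong : ∀ {x x' y y'} → θ x x' → θ y y' → θ (x ∨ y) (x' ∨ y')
      ∧-cong : ∀ {x x' y y'} → θ x x' → θ y y' → θ (x ∧ y) (x' ∧ y')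
      *-cong : ∀ {x x'} → θ x x' → θ (x *) (x' *)

  Sub : (P : Carrier → Set) → Set
  Sub P = Σ Carrier P

  record IsSubCongruence (P : Carrier → Set) (S : IsSubuniverse P)
                         (θ₀ : Sub P → Sub P → Set) : Set where
    open IsSubuniverse S
    field
      refl  : ∀ {a} → θ₀ a a
      sym   : ∀ {a b} → θ₀ a b → θ₀ b a
      trans : ∀ {a b c} → θ₀ a b → θ₀ b c → θ₀ a c
      ∨-cong : ∀ {a a' b b'} → θ₀ a a' → θ₀ b b' →
               θ₀ (proj₁ a ∨ proj₁ b , ∨-closed (proj₂ a) (proj₂ b))
                  (proj₁ a' ∨ proj₁ b' , ∨-closed (proj₂ a') (proj₂ b'))
      ∧-cong : ∀ {a a' b b'} → θ₀ a a' → θ₀ b b' →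
               θ₀ (proj₁ a ∧ proj₁ b , ∧-closed (proj₂ a) (proj₂ b))
                  (proj₁ a' ∧ proj₁ b' , ∧-closed (proj₂ a') (proj₂ b'))
      *-cong : ∀ {a a'} → θ₀ a a' →
               θ₀ ((proj₁ a) * , *-closed (proj₂ a)) ((proj₁ a') * , *-closed (proj₂ a'))

-- Let T be θ₀ read as a partial equivalence on Q, defined exactly on Q₀. First, the elements e with e T 1 form a ∧-closed set F, and "x ∧ e = y ∧ e for
-- some e ∈ F" is a congruence on Q which, on Q₀, identifies x ∧ x with y ∧ y whenever it
-- identifies x with y. Second, call x anchored if x is regular (x ∧ x = x) or x T x ∧ x; since
-- every join and meet is regular, collapsing all anchored elements into one class and adding
-- T is again a congruence. The intersection θ of the two congruences contains T because
-- x ∧ (x ↔ y) = x ∧ y = y ∧ (x ↔ y), where x ↔ y := (x ∧ y) ∨ (x* ∧ y*) is T-related to 1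
-- whenever x T y; conversely, two θ-related elements of Q₀ are T-related directly, or are
-- both anchored, and then x T x ∧ x T y ∧ y T y.
module Submission where

open import Defs
open import Algebra.Bundles using (CommutativeSemigroup)
import Algebra.Properties.CommutativeSemigroup as CommutativeSemigroupProperties
open import Algebra.Consequences.Propositional using (comm∧distrˡ⇒distrʳ)
open import Data.Product using (Σ; _×_; _,_; proj₁)
open import Data.Sum using (_⊎_; inj₁; inj₂)
open import Level using (Level; 0ℓ)
import Relation.Binary.Reasoning.Setoid as SetoidReasoning
open import Relation.Binary.PropositionalEquality as ≡ using (_≡_; cong; cong₂; subst; subst₂)

module _ {a ℓ : Level} (CS : CommutativeSemigroup a ℓ) where
  open CommutativeSemigroup CS
  open CommutativeSemigroupProperties CS using (interchange)
  open SetoidReasoning setoid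

  module _ (idemʳ : ∀ x y → x ∙ (y ∙ y) ≈ x ∙ y) where

    idemˡ : ∀ x y → (x ∙ x) ∙ y ≈ x ∙ y
    idemˡ x y = begin
      (x ∙ x) ∙ y  ≈⟨ comm (x ∙ x) y ⟩
      y ∙ (x ∙ x)  ≈⟨ idemʳ y x ⟩
      y ∙ x        ≈⟨ comm y x ⟩
      x ∙ y        ∎

    square-∙ : ∀ x y → (x ∙ y) ∙ (x ∙ y) ≈ x ∙ y
    square-∙ x y = begin
      (x ∙ y) ∙ (x ∙ y)  ≈⟨ interchange x y x y ⟩
      (x ∙ x) ∙ (y ∙ y)  ≈⟨ idemʳ (x ∙ x) y ⟩
      (x ∙ x) ∙ y        ≈⟨ idemˡ x y ⟩
      x ∙ y              ∎

module QBAlgebraProperties (Q : QBAlgebra) where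
  open QBAlgebra Q
  open ≡.≡-Reasoning

  commutativeSemigroup : (_∙_ : Carrier → Carrier → Carrier) →
                         (∀ x y z → (x ∙ y) ∙ z ≡ x ∙ (y ∙ z)) → (∀ x y → x ∙ y ≡ y ∙ x) →
                         CommutativeSemigroup 0ℓ 0ℓ
  commutativeSemigroup _∙_ assoc comm = record
    { Carrier = Carrier
    ; _≈_ = _≡_
    ; _∙_ = _∙_
    ; isCommutativeSemigroup = record
      { isSemigroup = record
        { isMagma = record { isEquivalence = ≡.isEquivalence ; ∙-cong = cong₂ _∙_ }
        ; assoc = assoc
        }
      ; comm = comm
      }
    }

  ∧-commutativeSemigroup : CommutativeSemigroup 0ℓ 0ℓ
  ∧-commutativeSemigroup = commutativeSemigroup _∧_ ∧-assoc ∧-comm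

  ∨-commutativeSemigroup : CommutativeSemigroup 0ℓ 0ℓ
  ∨-commutativeSemigroup = commutativeSemigroup _∨_ ∨-assoc ∨-comm

  module ∧ = CommutativeSemigroupProperties ∧-commutativeSemigroup
  module ∨ = CommutativeSemigroupProperties ∨-commutativeSemigroup

  Regular : Carrier → Set
  Regular x = x ∧ x ≡ x

  ∧-idemˡ : ∀ x y → (x ∧ x) ∧ y ≡ x ∧ y
  ∧-idemˡ = idemˡ ∧-commutativeSemigroup ∧-idem-r

  ∧-regular : ∀ x y → Regular (x ∧ y)
  ∧-regular = square-∙ ∧-commutativeSemigroup ∧-idem-r

  ∨-regular : ∀ x y → Regular (x ∨ y)
  ∨-regular x y = ≡.trans (≡.sym (∨∧-diag (x ∨ y))) (square-∙ ∨-commutativeSemigroup ∨-idem-r x y)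

  *-square : ∀ x → (x ∧ x) * ≡ x * ∧ x *
  *-square x = ≡.trans (*-∧∧ x) (∨∧-diag (x *))

  *-regular : ∀ {x} → Regular x → Regular (x *)
  *-regular {x} reg = ≡.trans (≡.sym (*-square x)) (cong _* reg)

  ∧-distribʳ-∨ : ∀ z x y → (x ∨ y) ∧ z ≡ (x ∧ z) ∨ (y ∧ z)
  ∧-distribʳ-∨ = comm∧distrˡ⇒distrʳ ∧-comm ∧-distrib-∨

  ∧-𝟏 : ∀ x → x ∧ 𝟏 ≡ x ∧ x
  ∧-𝟏 x = ≡.trans (cong (x ∧_) (≡.sym (∨-𝟏 x))) (∧-absorb x 𝟏)

  ∧-zeroˡ : ∀ x → 𝟎 ∧ x ≡ 𝟎
  ∧-zeroˡ x = ≡.trans (∧-comm 𝟎 x) (∧-𝟎 x)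

  𝟏-regular : Regular 𝟏
  𝟏-regular = ≡.trans (≡.sym (∨∧-diag 𝟏)) (∨-𝟏 𝟏)

  regular-∨-𝟎 : ∀ {z} → Regular z → z ∨ 𝟎 ≡ z
  regular-∨-𝟎 {z} reg = begin
    z ∨ 𝟎        ≡⟨ cong (z ∨_) (∧-𝟎 z) ⟨
    z ∨ (z ∧ 𝟎)  ≡⟨ ∨-absorb z 𝟎 ⟩
    z ∨ z        ≡⟨ ∨∧-diag z ⟩
    z ∧ z        ≡⟨ reg ⟩
    z            ∎

  *-∧-cancel : ∀ x → x * ∧ x ≡ 𝟎
  *-∧-cancel x = ≡.trans (∧-comm (x *) x) (∧-compl x)

  regular-∧-* : ∀ {y} x → Regular y → y ∧ x ≡ 𝟎 → y ≡ y ∧ x *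
  regular-∧-* {y} x reg disjoint = begin
    y                          ≡⟨ reg ⟨
    y ∧ y                      ≡⟨ ∧-𝟏 y ⟨
    y ∧ 𝟏                      ≡⟨ cong (y ∧_) (∨-compl x) ⟨
    y ∧ (x ∨ x *)              ≡⟨ ∧-distrib-∨ y x (x *) ⟩
    (y ∧ x) ∨ (y ∧ x *)        ≡⟨ cong (_∨ (y ∧ x *)) disjoint ⟩
    𝟎 ∨ (y ∧ x *)              ≡⟨ ∨-comm 𝟎 (y ∧ x *) ⟩
    (y ∧ x *) ∨ 𝟎              ≡⟨ regular-∨-𝟎 (∧-regular y (x *)) ⟩
    y ∧ x *                    ∎

  _↔_ : Carrier → Carrier → Carrier
  x ↔ y = (x ∧ y) ∨ (x * ∧ y *)

  ↔-comm : ∀ x y → x ↔ y ≡ y ↔ x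
  ↔-comm x y = cong₂ _∨_ (∧-comm x y) (∧-comm (x *) (y *))

  ↔-refl : ∀ x → x ↔ x ≡ 𝟏
  ↔-refl x = begin
    (x ∧ x) ∨ (x * ∧ x *)    ≡⟨ cong₂ _∨_ (∨∧-diag x) (∨∧-diag (x *)) ⟨
    (x ∨ x) ∨ (x * ∨ x *)    ≡⟨ ∨.interchange x x (x *) (x *) ⟩
    (x ∨ x *) ∨ (x ∨ x *)    ≡⟨ cong₂ _∨_ (∨-compl x) (∨-compl x) ⟩
    𝟏 ∨ 𝟏                    ≡⟨ ∨-𝟏 𝟏 ⟩
    𝟏                        ∎

  ∧-↔ : ∀ x y → x ∧ (x ↔ y) ≡ x ∧ y
  ∧-↔ x y = begin
    x ∧ ((x ∧ y) ∨ (x * ∧ y *))          ≡⟨ ∧-distrib-∨ x (x ∧ y) (x * ∧ y *) ⟩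
    (x ∧ (x ∧ y)) ∨ (x ∧ (x * ∧ y *))    ≡⟨ cong₂ _∨_ (∧-assoc x x y) (∧-assoc x (x *) (y *)) ⟨
    ((x ∧ x) ∧ y) ∨ ((x ∧ x *) ∧ y *)    ≡⟨ cong₂ _∨_ (∧-idemˡ x y) (cong (_∧ y *) (∧-compl x)) ⟩
    (x ∧ y) ∨ (𝟎 ∧ y *)                  ≡⟨ cong ((x ∧ y) ∨_) (∧-zeroˡ (y *)) ⟩
    (x ∧ y) ∨ 𝟎                          ≡⟨ regular-∨-𝟎 (∧-regular x y) ⟩
    x ∧ y                                ∎

  ∧-↔ʳ : ∀ x y → y ∧ (x ↔ y) ≡ x ∧ y
  ∧-↔ʳ x y = begin
    y ∧ (x ↔ y)  ≡⟨ cong (y ∧_) (↔-comm x y) ⟩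
    y ∧ (y ↔ x)  ≡⟨ ∧-↔ y x ⟩
    y ∧ x        ≡⟨ ∧-comm y x ⟩
    x ∧ y        ∎

module _ (Q : QBAlgebra) where
  open QBAlgebra Q
  open QBAlgebraProperties Q
  open ≡.≡-Reasoning

  ∩-isCongruence : ∀ {θ φ} → IsCongruence Q θ → IsCongruence Q φ →
                   IsCongruence Q (λ x y → θ x y × φ x y)
  ∩-isCongruence θ φ = record
    { refl = θ.refl , φ.refl
    ; sym = λ (s , t) → θ.sym s , φ.sym t
    ; trans = λ (s , t) (s′ , t′) → θ.trans s s′ , φ.trans t t′
    ; ∨-cong = λ (s , t) (s′ , t′) → θ.∨-cong s s′ , φ.∨-cong t t′
    ; ∧-cong = λ (s , t) (s′ , t′) → θ.∧-cong s s′ , φ.∧-cong t t′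
    ; *-cong = λ (s , t) → θ.*-cong s , φ.*-cong t
    }
    where
    module θ = IsCongruence θ
    module φ = IsCongruence φ

  AgreeMod : (Carrier → Set) → Carrier → Carrier → Set
  AgreeMod F x y = Σ Carrier λ e → F e × (x ∧ e ≡ y ∧ e)

  agree-∧ʳ : ∀ {x y} e f → x ∧ e ≡ y ∧ e → x ∧ (e ∧ f) ≡ y ∧ (e ∧ f)
  agree-∧ʳ {x} {y} e f agree = begin
    x ∧ (e ∧ f)  ≡⟨ ∧-assoc x e f ⟨
    (x ∧ e) ∧ f  ≡⟨ cong (_∧ f) agree ⟩
    (y ∧ e) ∧ f  ≡⟨ ∧-assoc y e f ⟩
    y ∧ (e ∧ f)  ∎

  agree-∧ˡ : ∀ {x y} e f → x ∧ f ≡ y ∧ f → x ∧ (e ∧ f) ≡ y ∧ (e ∧ f)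
  agree-∧ˡ {x} {y} e f agree = begin
    x ∧ (e ∧ f)  ≡⟨ cong (x ∧_) (∧-comm e f) ⟩
    x ∧ (f ∧ e)  ≡⟨ agree-∧ʳ f e agree ⟩
    y ∧ (f ∧ e)  ≡⟨ cong (y ∧_) (∧-comm f e) ⟩
    y ∧ (e ∧ f)  ∎

  agree-* : ∀ {x y} e → x ∧ e ≡ y ∧ e → x * ∧ e ≡ y * ∧ e
  agree-* {x} {y} e agree = begin
    x * ∧ e            ≡⟨ regular-∧-* y (∧-regular (x *) e) (disjoint agree) ⟩
    (x * ∧ e) ∧ y *    ≡⟨ ∧.xy∙z≈zy∙x (x *) e (y *) ⟩
    (y * ∧ e) ∧ x *    ≡⟨ regular-∧-* x (∧-regular (y *) e) (disjoint (≡.sym agree)) ⟨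
    y * ∧ e            ∎
    where
    disjoint : ∀ {u v} → u ∧ e ≡ v ∧ e → (u * ∧ e) ∧ v ≡ 𝟎
    disjoint {u} {v} agree′ = begin
      (u * ∧ e) ∧ v  ≡⟨ ∧.xy∙z≈x∙zy (u *) e v ⟩
      u * ∧ (v ∧ e)  ≡⟨ cong (u * ∧_) agree′ ⟨
      u * ∧ (u ∧ e)  ≡⟨ ∧-assoc (u *) u e ⟨
      (u * ∧ u) ∧ e  ≡⟨ cong (_∧ e) (*-∧-cancel u) ⟩
      𝟎 ∧ e          ≡⟨ ∧-zeroˡ e ⟩
      𝟎              ∎

  agree-isCongruence : ∀ {F} → F 𝟏 → (∀ {e f} → F e → F f → F (e ∧ f)) →
                       IsCongruence Q (AgreeMod F)
  agree-isCongruence F-𝟏 F-∧ = record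
    { refl = 𝟏 , F-𝟏 , ≡.refl
    ; sym = λ (e , Fe , agree) → e , Fe , ≡.sym agree
    ; trans = λ (e , Fe , p) (f , Ff , q) →
        e ∧ f , F-∧ Fe Ff , ≡.trans (agree-∧ʳ e f p) (agree-∧ˡ e f q)
    ; ∨-cong = λ {x} {x′} {y} {y′} (e , Fe , p) (f , Ff , q) → e ∧ f , F-∧ Fe Ff , (begin
        (x ∨ y) ∧ (e ∧ f)                ≡⟨ ∧-distribʳ-∨ (e ∧ f) x y ⟩
        (x ∧ (e ∧ f)) ∨ (y ∧ (e ∧ f))    ≡⟨ cong₂ _∨_ (agree-∧ʳ e f p) (agree-∧ˡ e f q) ⟩
        (x′ ∧ (e ∧ f)) ∨ (y′ ∧ (e ∧ f))  ≡⟨ ∧-distribʳ-∨ (e ∧ f) x′ y′ ⟨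
        (x′ ∨ y′) ∧ (e ∧ f)              ∎)
    ; ∧-cong = λ {x} {x′} {y} {y′} (e , Fe , p) (f , Ff , q) → e ∧ f , F-∧ Fe Ff , (begin
        (x ∧ y) ∧ (e ∧ f)                ≡⟨ ∧.interchange x y e f ⟩
        (x ∧ e) ∧ (y ∧ f)                ≡⟨ cong₂ _∧_ p q ⟩
        (x′ ∧ e) ∧ (y′ ∧ f)              ≡⟨ ∧.interchange x′ e y′ f ⟩
        (x′ ∧ y′) ∧ (e ∧ f)              ∎)
    ; *-cong = λ (e , Fe , agree) → e , Fe , agree-* e agree
    }

  record IsPartialCongruence (T : Carrier → Carrier → Set) : Set where
    field
      sym    : ∀ {x y} → T x y → T y x
      trans  : ∀ {x y z} → T x y → T y z → T x z
      ∨-cong : ∀ {x x′ y y′} → T x x′ → T y y′ → T (x ∨ y) (x′ ∨ y′)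
      ∧-cong : ∀ {x x′ y y′} → T x x′ → T y y′ → T (x ∧ y) (x′ ∧ y′)
      *-cong : ∀ {x x′} → T x x′ → T (x *) (x′ *)

    reflˡ : ∀ {x y} → T x y → T x x
    reflˡ t = trans t (sym t)

  module PartialCongruence {T : Carrier → Carrier → Set} (T-isPC : IsPartialCongruence T) where
    open IsPartialCongruence T-isPC

    Anchored : Carrier → Set
    Anchored x = Regular x ⊎ T x (x ∧ x)

    anchored⇒T-∧ : ∀ {x} → Anchored x → T x x → T x (x ∧ x)
    anchored⇒T-∧ {x} (inj₁ reg) t = subst (T x) (≡.sym reg) t
    anchored⇒T-∧ (inj₂ t) _ = t

    anchored-resp : ∀ {x y} → T x y → Anchored x → Anchored y
    anchored-resp t anchored =
      inj₂ (trans (sym t) (trans (anchored⇒T-∧ anchored (reflˡ t)) (∧-cong t t)))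

    anchored-* : ∀ {x} → Anchored x → Anchored (x *)
    anchored-* (inj₁ reg) = inj₁ (*-regular reg)
    anchored-* {x} (inj₂ t) = inj₂ (subst (T (x *)) (*-square x) (*-cong t))

    Collapse : Carrier → Carrier → Set
    Collapse x y = x ≡ y ⊎ (Anchored x × Anchored y) ⊎ T x y

    collapse-sym : ∀ {x y} → Collapse x y → Collapse y x
    collapse-sym (inj₁ eq) = inj₁ (≡.sym eq)
    collapse-sym (inj₂ (inj₁ (ax , ay))) = inj₂ (inj₁ (ay , ax))
    collapse-sym (inj₂ (inj₂ t)) = inj₂ (inj₂ (sym t))

    collapse-trans : ∀ {x y z} → Collapse x y → Collapse y z → Collapse x z
    collapse-trans (inj₁ ≡.refl) c = c
    collapse-trans c (inj₁ ≡.refl) = c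
    collapse-trans (inj₂ (inj₁ (ax , _))) (inj₂ (inj₁ (_ , az))) = inj₂ (inj₁ (ax , az))
    collapse-trans (inj₂ (inj₁ (ax , ay))) (inj₂ (inj₂ t)) =
      inj₂ (inj₁ (ax , anchored-resp t ay))
    collapse-trans (inj₂ (inj₂ t)) (inj₂ (inj₁ (ay , az))) =
      inj₂ (inj₁ (anchored-resp (sym t) ay , az))
    collapse-trans (inj₂ (inj₂ t)) (inj₂ (inj₂ u)) = inj₂ (inj₂ (trans t u))

    collapse-* : ∀ {x y} → Collapse x y → Collapse (x *) (y *)
    collapse-* (inj₁ eq) = inj₁ (cong _* eq)
    collapse-* (inj₂ (inj₁ (ax , ay))) = inj₂ (inj₁ (anchored-* ax , anchored-* ay))
    collapse-* (inj₂ (inj₂ t)) = inj₂ (inj₂ (*-cong t))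

    collapse-isCongruence : IsCongruence Q Collapse
    collapse-isCongruence = record
      { refl = inj₁ ≡.refl
      ; sym = collapse-sym
      ; trans = collapse-trans
      ; ∨-cong = λ {x} {x′} {y} {y′} _ _ →
          inj₂ (inj₁ (inj₁ (∨-regular x y) , inj₁ (∨-regular x′ y′)))
      ; ∧-cong = λ {x} {x′} {y} {y′} _ _ →
          inj₂ (inj₁ (inj₁ (∧-regular x y) , inj₁ (∧-regular x′ y′)))
      ; *-cong = collapse-*
      }

    T-𝟏 : Carrier → Set
    T-𝟏 e = T e 𝟏

    agree⇒T-∧ : ∀ {x y} → AgreeMod T-𝟏 x y → T x x → T y y → T (x ∧ x) (y ∧ y)
    agree⇒T-∧ {x} {y} (e , e-T-𝟏 , agree) tx ty =
      subst₂ T (∧-𝟏 x) (∧-𝟏 y) (trans (∧-cong tx (sym e-T-𝟏)) x∧e-T-y∧𝟏)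
      where
      x∧e-T-y∧𝟏 : T (x ∧ e) (y ∧ 𝟏)
      x∧e-T-y∧𝟏 = subst (λ z → T z (y ∧ 𝟏)) (≡.sym agree) (∧-cong ty e-T-𝟏)

    T-↔-𝟏 : ∀ {x y} → T x y → T-𝟏 (x ↔ y)
    T-↔-𝟏 {x} {y} t = subst (T (x ↔ y)) (↔-refl x) (sym (↔-cong (reflˡ t) t))
      where
      ↔-cong : ∀ {u u′ v v′} → T u u′ → T v v′ → T (u ↔ v) (u′ ↔ v′)
      ↔-cong s t = ∨-cong (∧-cong s t) (∧-cong (*-cong s) (*-cong t))

    module _ (𝟏-T-𝟏 : T 𝟏 𝟏) where

      Extension : Carrier → Carrier → Set
      Extension x y = AgreeMod T-𝟏 x y × Collapse x y

      extension-isCongruence : IsCongruence Q Extension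
      extension-isCongruence = ∩-isCongruence
        (agree-isCongruence 𝟏-T-𝟏 (λ s t → subst (T _) 𝟏-regular (∧-cong s t)))
        collapse-isCongruence

      T⇒extension : ∀ {x y} → T x y → Extension x y
      T⇒extension {x} {y} t =
        (x ↔ y , T-↔-𝟏 t , ≡.trans (∧-↔ x y) (≡.sym (∧-↔ʳ x y))) , inj₂ (inj₂ t)

      extension⇒T : ∀ {x y} → T x x → T y y → Extension x y → T x y
      extension⇒T tx _ (_ , inj₁ ≡.refl) = tx
      extension⇒T _ _ (_ , inj₂ (inj₂ t)) = t
      extension⇒T tx ty (agree , inj₂ (inj₁ (ax , ay))) =
        trans (anchored⇒T-∧ ax tx) (trans (agree⇒T-∧ agree tx ty) (sym (anchored⇒T-∧ ay ty)))

  module Restriction {P : Carrier → Set} (S : IsSubuniverse Q P) {θ₀ : Sub Q P → Sub Q P → Set}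
                     (θ₀-isCong : IsSubCongruence Q P S θ₀) where
    open IsSubuniverse S
    private module θ₀ = IsSubCongruence θ₀-isCong

    Restrict : Carrier → Carrier → Set
    Restrict x y = Σ (P x) λ px → Σ (P y) λ py → θ₀ (x , px) (y , py)

    restrict⇒θ₀ : ∀ {x y} → Restrict x y → (px : P x) (py : P y) → θ₀ (x , px) (y , py)
    restrict⇒θ₀ (px′ , py′ , t) px py rewrite prop px px′ | prop py py′ = t

    restrict-refl : ∀ {x} → P x → Restrict x x
    restrict-refl px = px , px , θ₀.refl

    restrict-isPartialCongruence : IsPartialCongruence Restrict
    restrict-isPartialCongruence = record
      { sym = λ (px , py , t) → py , px , θ₀.sym t
      ; trans = λ (px , py , t) u@(_ , pz , _) → px , pz , θ₀.trans t (restrict⇒θ₀ u py pz)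
      ; ∨-cong = λ (px , px′ , t) (py , py′ , u) → ∨-closed px py , ∨-closed px′ py′ , θ₀.∨-cong t u
      ; ∧-cong = λ (px , px′ , t) (py , py′ , u) → ∧-closed px py , ∧-closed px′ py′ , θ₀.∧-cong t u
      ; *-cong = λ (px , px′ , t) → *-closed px , *-closed px′ , θ₀.*-cong t
      }

theorem5p6 : (Q : QBAlgebra) (P : QBAlgebra.Carrier Q → Set) (S : IsSubuniverse Q P)
    (θ₀ : Sub Q P → Sub Q P → Set) → IsSubCongruence Q P S θ₀ →
    Σ (QBAlgebra.Carrier Q → QBAlgebra.Carrier Q → Set) (λ θ →
      IsCongruence Q θ ×
      ((a b : Sub Q P) → (θ₀ a b → θ (proj₁ a) (proj₁ b)) × (θ (proj₁ a) (proj₁ b) → θ₀ a b)))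
theorem5p6 Q P S θ₀ θ₀-isCong =
  Extension 𝟏-restricted , extension-isCongruence 𝟏-restricted ,
  λ (x , px) (y , py) →
    (λ t → T⇒extension 𝟏-restricted (px , py , t)) ,
    (λ ext → restrict⇒θ₀ (extension⇒T 𝟏-restricted (restrict-refl px) (restrict-refl py) ext) px py)
  where
  open QBAlgebra Q using (𝟏)
  open Restriction Q S θ₀-isCong
  open PartialCongruence Q restrict-isPartialCongruence

  𝟏-restricted : Restrict 𝟏 𝟏
  𝟏-restricted = restrict-refl (IsSubuniverse.𝟏-closed S)
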